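{- For every constant specification $CS$ for $\mathcal{GLP}_0$: $(Th_{\mathcal{GLP}_{CS}})^\circ\subsetneq Th_{\mathcal{GS}4_\Box}$.
   Context: Justification terms $Jt$ are generated by $t::= c\mid x\mid [t+t]\mid [t\cdot t]\mid\, !t\mid\, ?t$, where $c$ ranges over constants $C=\{c_i\mid i\in\mathbb{N}\}$ and $x$ over variables $V=\{x_i\}$. The language $\mathcal{L}_J$ is $\phi::=\bot\mid p\mid(\phi\rightarrow\phi)\mid(\phi\land\phi)\mid t:\phi$ with $p\in Var=\{p_i\mid i\in\mathbb{N}\}$; $\neg\phi:=\phi\rightarrow\bot$. The modal language $\mathcal{L}_\Box$ is $\phi::=\bot\mid p\mid(\phi\land\phi)\mid(\phi\rightarrow\phi)\mid\Box\phi$. The calculus $\mathcal{G}$ has the axiom schemes (A1) $(\phi\rightarrow\psi)\rightarrow((\psi\rightarrow\chi)\rightarrow(\phi\rightarrow\chi))$; (A2) $(\phi\land\psi)\rightarrow\phi$; (A3) $(\phi\land\psi)\rightarrow(\psi\land\phi)$; (A5a) $(\phi\rightarrow(\psi\rightarrow\chi))\rightarrow((\phi\land\psi)\rightarrow\chi)$; (A5b) $((\phi\land\psi)\rightarrow\chi)\rightarrow(\phi\rightarrow(\psi\rightarrow\chi))$; (A6) $((\phi\rightarrow\psi)\rightarrow\chi)\rightarrow(((\psi\rightarrow\phi)\rightarrow\chi)\rightarrow\chi)$; (A7) $\bot\rightarrow\phi$; (G4) $\phi\rightarrow(\phi\land\phi)$; and the rule (MP): from $\phi\rightarrow\psi$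 and $\phi$ infer $\psi$. $\mathcal{GLP}_0$ is $\mathcal{G}$ over $\mathcal{L}_J$ plus (J) $t:(\phi\rightarrow\psi)\rightarrow(s:\phi\rightarrow[t\cdot s]:\psi)$, (+) $t:\phi\rightarrow[t+s]:\phi$, $s:\phi\rightarrow[t+s]:\phi$, (F) $t:\phi\rightarrow\phi$, and (!) $t:\phi\rightarrow\, !t:t:\phi$. A constant specification for $\mathcal{GLP}_0$ is a set $CS$ of formulas $c_{i_n}:\dots:c_{i_1}:\phi$ ($n\ge1$, $c_{i_k}\in C$, $\phi$ an axiom instance of $\mathcal{GLP}_0$) such that whenever $c_{i_n}:\dots:c_{i_1}:\phi\in CS$, also $c_{i_k}:\dots:c_{i_1}:\phi\in CS$ for all $k\le n$. $\mathcal{GLP}_{CS}$ is $\mathcal{GLP}_0$ plus the rule: from $c:\phi\in CS$ infer $c:\phi$. $\mathcal{GS}4_\Box$ over $\mathcal{L}_\Box$ consists of the axiom schemes of $\mathcal{G}$, (K) $\Box(\phi\rightarrow\psi)\rightarrow(\Box\phi\rightarrow\Box\psi)$, (Z) $\neg\neg\Box\phi\rightarrow\Box\neg\neg\phi$, (T) $\Box\phi\rightarrow\phi$, (4) $\Box\phi\rightarrow\Box\Box\phi$, the rule (MP), and the rule (N$\Box$): from a theorem $\phi$ infer $\Box\phi$. For a proof system $\mathcal{S}$ over $\mathcal{L}$, $Th_\mathcal{S}=\{\phi\in\mathcal{L}\mid\ \vdash_\mathcal{S}\phi\}$. The forgetful projection $\circ:\mathcal{L}_J\to\mathcal{L}_\Box$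 is given by $p^\circ=p$, $\bot^\circ=\bot$, $(\phi\land\psi)^\circ=\phi^\circ\land\psi^\circ$, $(\phi\rightarrow\psi)^\circ=\phi^\circ\rightarrow\psi^\circ$, $(t:\phi)^\circ=\Box\phi^\circ$, and $\Gamma^\circ=\{\phi^\circ\mid\phi\in\Gamma\}$. -}

module Defs where

open import Data.Nat using (ℕ)
open import Data.Product using (Σ; _×_; _,_)
open import Relation.Binary.PropositionalEquality using (_≡_)
open import Relation.Nullary using (¬_)

data Tm : Set where
  cst  : ℕ → Tm
  var  : ℕ → Tm
  _⊕_  : Tm → Tm → Tm
  _⊙_  : Tm → Tm → Tm
  !_   : Tm → Tm
  ¿_   : Tm → Tm

infixr 5 _⇒_
infixr 6 _∧_
infixr 7 _∶_

data FmJ : Set where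
  ⊥J  : FmJ
  pJ  : ℕ → FmJ
  _⇒_ : FmJ → FmJ → FmJ
  _∧_ : FmJ → FmJ → FmJ
  _∶_ : Tm → FmJ → FmJ

¬J_ : FmJ → FmJ
¬J φ = φ ⇒ ⊥J

-- Axiom instances of GLP_0 (G-axioms over L_J plus J, +, F, !)
data AxGLP : FmJ → Set where
  A1  : ∀ φ ψ χ → AxGLP ((φ ⇒ ψ) ⇒ ((ψ ⇒ χ) ⇒ (φ ⇒ χ)))
  A2  : ∀ φ ψ → AxGLP ((φ ∧ ψ) ⇒ φ)
  A3  : ∀ φ ψ → AxGLP ((φ ∧ ψ) ⇒ (ψ ∧ φ))
  A5a : ∀ φ ψ χ → AxGLP ((φ ⇒ (ψ ⇒ χ)) ⇒ ((φ ∧ ψ) ⇒ χ))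
  A5b : ∀ φ ψ χ → AxGLP (((φ ∧ ψ) ⇒ χ) ⇒ (φ ⇒ (ψ ⇒ χ)))
  A6  : ∀ φ ψ χ → AxGLP (((φ ⇒ ψ) ⇒ χ) ⇒ (((ψ ⇒ φ) ⇒ χ) ⇒ χ))
  A7  : ∀ φ → AxGLP (⊥J ⇒ φ)
  G4  : ∀ φ → AxGLP (φ ⇒ (φ ∧ φ))
  AJ  : ∀ t s φ ψ → AxGLP ((t ∶ (φ ⇒ ψ)) ⇒ ((s ∶ φ) ⇒ ((t ⊙ s) ∶ ψ)))
  A+l : ∀ t s φ → AxGLP ((t ∶ φ) ⇒ ((t ⊕ s) ∶ φ))
  A+r : ∀ t s φ → AxGLP ((s ∶ φ) ⇒ ((t ⊕ s) ∶ φ))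
  AF  : ∀ t φ → AxGLP ((t ∶ φ) ⇒ φ)
  A!  : ∀ t φ → AxGLP ((t ∶ φ) ⇒ ((! t) ∶ (t ∶ φ)))

data ConstChain : FmJ → Set where
  base : ∀ i φ → AxGLP φ → ConstChain (cst i ∶ φ)
  step : ∀ i χ → ConstChain χ → ConstChain (cst i ∶ χ)

record ConstSpec : Set₁ where
  field
    mem    : FmJ → Set
    shape  : ∀ χ → mem χ → ConstChain χ
    closed : ∀ i χ → mem (cst i ∶ χ) → ConstChain χ → mem χ

data GLP⊢ (CS : ConstSpec) : FmJ → Set where
  ax  : ∀ {φ} → AxGLP φ → GLP⊢ CS φ
  mp  : ∀ {φ ψ} → GLP⊢ CS (φ ⇒ ψ) → GLP⊢ CS φ → GLP⊢ CS ψ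
  ans : ∀ {i φ} → ConstSpec.mem CS (cst i ∶ φ) → GLP⊢ CS (cst i ∶ φ)

infixr 5 _⇒□_
infixr 6 _∧□_

data Fm□ : Set where
  ⊥□   : Fm□
  p□   : ℕ → Fm□
  _∧□_ : Fm□ → Fm□ → Fm□
  _⇒□_ : Fm□ → Fm□ → Fm□
  □_   : Fm□ → Fm□

¬□_ : Fm□ → Fm□
¬□ φ = φ ⇒□ ⊥□

data GS4⊢ : Fm□ → Set where
  A1  : ∀ φ ψ χ → GS4⊢ ((φ ⇒□ ψ) ⇒□ ((ψ ⇒□ χ) ⇒□ (φ ⇒□ χ)))
  A2  : ∀ φ ψ → GS4⊢ ((φ ∧□ ψ) ⇒□ φ)
  A3  : ∀ φ ψ → GS4⊢ ((φ ∧□ ψ) ⇒□ (ψ ∧□ φ))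
  A5a : ∀ φ ψ χ → GS4⊢ ((φ ⇒□ (ψ ⇒□ χ)) ⇒□ ((φ ∧□ ψ) ⇒□ χ))
  A5b : ∀ φ ψ χ → GS4⊢ (((φ ∧□ ψ) ⇒□ χ) ⇒□ (φ ⇒□ (ψ ⇒□ χ)))
  A6  : ∀ φ ψ χ → GS4⊢ (((φ ⇒□ ψ) ⇒□ χ) ⇒□ (((ψ ⇒□ φ) ⇒□ χ) ⇒□ χ))
  A7  : ∀ φ → GS4⊢ (⊥□ ⇒□ φ)
  G4  : ∀ φ → GS4⊢ (φ ⇒□ (φ ∧□ φ))
  K   : ∀ φ ψ → GS4⊢ ((□ (φ ⇒□ ψ)) ⇒□ ((□ φ) ⇒□ (□ ψ)))
  Z   : ∀ φ → GS4⊢ ((¬□ (¬□ (□ φ))) ⇒□ (□ (¬□ (¬□ φ))))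
  T   : ∀ φ → GS4⊢ ((□ φ) ⇒□ φ)
  A4  : ∀ φ → GS4⊢ ((□ φ) ⇒□ (□ (□ φ)))
  mp  : ∀ {φ ψ} → GS4⊢ (φ ⇒□ ψ) → GS4⊢ φ → GS4⊢ ψ
  nec : ∀ {φ} → GS4⊢ φ → GS4⊢ (□ φ)

_° : FmJ → Fm□
⊥J ° = ⊥□
pJ n ° = p□ n
(φ ⇒ ψ) ° = (φ °) ⇒□ (ψ °)
(φ ∧ ψ) ° = (φ °) ∧□ (ψ °)
(t ∶ φ) ° = □ (φ °)

ProperSubsetThm : ConstSpec → Set
ProperSubsetThm CS =
  (∀ φ → GLP⊢ CS φ → GS4⊢ (φ °))
  × Σ Fm□ (λ ψ → GS4⊢ ψ × ¬ (Σ FmJ (λ φ → GLP⊢ CS φ × (φ ° ≡ ψ))))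

module Submission where

open import Defs
open import Data.Product using (Σ; _×_; _,_)
open import Relation.Binary.PropositionalEquality using (_≡_; refl; _≢_; subst)
open import Relation.Nullary using (¬_; Dec; yes; no)
open import Relation.Nullary.Decidable using (from-yes)

-- Projecting a GLP_CS derivation axiom by axiom gives a GS4_□ derivation:
-- J, F and ! become K, T and 4, both + axioms become φ → φ, and a constant
-- specification c_n : … : c_1 : φ becomes iterated necessitation of φ°.
--
-- For properness, Z is refuted by a three-valued Gödel model with two
-- evaluations.  The auxiliary one sends every atom to 0 and reads □ as the
-- identity; the main one sends every atom to ½ and reads □A as the value of A,
-- capped at ½ unless A is true in the auxiliary evaluation.  Both validate all
-- projected GLP_0 axioms and modus ponens, and since the auxiliary value of a
-- projected axiom is 1, they also validate every projected constant
-- specification.  But ¬¬□p → □¬¬p takes the value ½.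

⊢□-refl : ∀ φ → GS4⊢ (φ ⇒□ φ)
⊢□-refl φ = mp (mp (A1 φ (φ ∧□ φ) φ) (G4 φ)) (A2 φ φ)

⊢□-axiom° : ∀ {φ} → AxGLP φ → GS4⊢ (φ °)
⊢□-axiom° (A1 φ ψ χ)    = A1 _ _ _
⊢□-axiom° (A2 φ ψ)      = A2 _ _
⊢□-axiom° (A3 φ ψ)      = A3 _ _
⊢□-axiom° (A5a φ ψ χ)   = A5a _ _ _
⊢□-axiom° (A5b φ ψ χ)   = A5b _ _ _
⊢□-axiom° (A6 φ ψ χ)    = A6 _ _ _
⊢□-axiom° (A7 φ)        = A7 _
⊢□-axiom° (G4 φ)        = G4 _
⊢□-axiom° (AJ t s φ ψ)  = K _ _
⊢□-axiom° (A+l t s φ)   = ⊢□-refl _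
⊢□-axiom° (A+r t s φ)   = ⊢□-refl _
⊢□-axiom° (AF t φ)      = T _
⊢□-axiom° (A! t φ)      = A4 _

⊢□-constChain° : ∀ {χ} → ConstChain χ → GS4⊢ (χ °)
⊢□-constChain° (base i φ a) = nec (⊢□-axiom° a)
⊢□-constChain° (step i χ c) = nec (⊢□-constChain° c)

⊢□-forget : ∀ CS φ → GLP⊢ CS φ → GS4⊢ (φ °)
⊢□-forget CS φ (ax a)   = ⊢□-axiom° a
⊢□-forget CS φ (mp d e) = mp (⊢□-forget CS _ d) (⊢□-forget CS _ e)
⊢□-forget CS φ (ans m)  = ⊢□-constChain° (ConstSpec.shape CS _ m)

data G₃ : Set where
  0ᵍ ½ᵍ 1ᵍ : G₃

_⊓_ : G₃ → G₃ → G₃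
0ᵍ ⊓ b  = 0ᵍ
½ᵍ ⊓ 0ᵍ = 0ᵍ
½ᵍ ⊓ ½ᵍ = ½ᵍ
½ᵍ ⊓ 1ᵍ = ½ᵍ
1ᵍ ⊓ b  = b

_⟶_ : G₃ → G₃ → G₃
0ᵍ ⟶ b  = 1ᵍ
½ᵍ ⟶ 0ᵍ = 0ᵍ
½ᵍ ⟶ ½ᵍ = 1ᵍ
½ᵍ ⟶ 1ᵍ = 1ᵍ
1ᵍ ⟶ b  = b

_≟1 : ∀ a → Dec (a ≡ 1ᵍ)
0ᵍ ≟1 = no λ ()
½ᵍ ≟1 = no λ ()
1ᵍ ≟1 = yes refl

∀G₃? : {P : G₃ → Set} → (∀ a → Dec (P a)) → Dec (∀ a → P a)
∀G₃? P? with P? 0ᵍ | P? ½ᵍ | P? 1ᵍ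
... | yes p₀ | yes p½ | yes p₁ = yes λ { 0ᵍ → p₀ ; ½ᵍ → p½ ; 1ᵍ → p₁ }
... | no ¬p₀ | _      | _      = no λ p → ¬p₀ (p 0ᵍ)
... | yes _  | no ¬p½ | _      = no λ p → ¬p½ (p ½ᵍ)
... | yes _  | yes _  | no ¬p₁ = no λ p → ¬p₁ (p 1ᵍ)

⟶-mp : ∀ {a b} → (a ⟶ b) ≡ 1ᵍ → a ≡ 1ᵍ → b ≡ 1ᵍ
⟶-mp e refl = e

⟶-refl : ∀ a → (a ⟶ a) ≡ 1ᵍ
⟶-refl = from-yes (∀G₃? λ a → (a ⟶ a) ≟1)

⟶-A1 : ∀ a b c → ((a ⟶ b) ⟶ ((b ⟶ c) ⟶ (a ⟶ c))) ≡ 1ᵍ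
⟶-A1 = from-yes (∀G₃? λ a → ∀G₃? λ b → ∀G₃? λ c → ((a ⟶ b) ⟶ ((b ⟶ c) ⟶ (a ⟶ c))) ≟1)

⟶-A2 : ∀ a b → ((a ⊓ b) ⟶ a) ≡ 1ᵍ
⟶-A2 = from-yes (∀G₃? λ a → ∀G₃? λ b → ((a ⊓ b) ⟶ a) ≟1)

⟶-A3 : ∀ a b → ((a ⊓ b) ⟶ (b ⊓ a)) ≡ 1ᵍ
⟶-A3 = from-yes (∀G₃? λ a → ∀G₃? λ b → ((a ⊓ b) ⟶ (b ⊓ a)) ≟1)

⟶-A5a : ∀ a b c → ((a ⟶ (b ⟶ c)) ⟶ ((a ⊓ b) ⟶ c)) ≡ 1ᵍ
⟶-A5a = from-yes (∀G₃? λ a → ∀G₃? λ b → ∀G₃? λ c → ((a ⟶ (b ⟶ c)) ⟶ ((a ⊓ b) ⟶ c)) ≟1)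

⟶-A5b : ∀ a b c → (((a ⊓ b) ⟶ c) ⟶ (a ⟶ (b ⟶ c))) ≡ 1ᵍ
⟶-A5b = from-yes (∀G₃? λ a → ∀G₃? λ b → ∀G₃? λ c → (((a ⊓ b) ⟶ c) ⟶ (a ⟶ (b ⟶ c))) ≟1)

⟶-A6 : ∀ a b c → (((a ⟶ b) ⟶ c) ⟶ (((b ⟶ a) ⟶ c) ⟶ c)) ≡ 1ᵍ
⟶-A6 = from-yes (∀G₃? λ a → ∀G₃? λ b → ∀G₃? λ c → (((a ⟶ b) ⟶ c) ⟶ (((b ⟶ a) ⟶ c) ⟶ c)) ≟1)

⟶-G4 : ∀ a → (a ⟶ (a ⊓ a)) ≡ 1ᵍ
⟶-G4 = from-yes (∀G₃? λ a → (a ⟶ (a ⊓ a)) ≟1)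

capped : G₃ → G₃ → G₃
capped 1ᵍ x = x
capped _  x = ½ᵍ ⊓ x

capped-K : ∀ a b c d → (capped (a ⟶ b) (c ⟶ d) ⟶ (capped a c ⟶ capped b d)) ≡ 1ᵍ
capped-K = from-yes (∀G₃? λ a → ∀G₃? λ b → ∀G₃? λ c → ∀G₃? λ d →
  (capped (a ⟶ b) (c ⟶ d) ⟶ (capped a c ⟶ capped b d)) ≟1)

capped-T : ∀ a c → (capped a c ⟶ c) ≡ 1ᵍ
capped-T = from-yes (∀G₃? λ a → ∀G₃? λ c → (capped a c ⟶ c) ≟1)

capped-4 : ∀ a c → (capped a c ⟶ capped a (capped a c)) ≡ 1ᵍ
capped-4 = from-yes (∀G₃? λ a → ∀G₃? λ c → (capped a c ⟶ capped a (capped a c)) ≟1)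

⟦_⟧₀ : Fm□ → G₃
⟦ ⊥□ ⟧₀     = 0ᵍ
⟦ p□ n ⟧₀   = 0ᵍ
⟦ A ∧□ B ⟧₀ = ⟦ A ⟧₀ ⊓ ⟦ B ⟧₀
⟦ A ⇒□ B ⟧₀ = ⟦ A ⟧₀ ⟶ ⟦ B ⟧₀
⟦ □ A ⟧₀    = ⟦ A ⟧₀

⟦_⟧ : Fm□ → G₃
⟦ ⊥□ ⟧     = 0ᵍ
⟦ p□ n ⟧   = ½ᵍ
⟦ A ∧□ B ⟧ = ⟦ A ⟧ ⊓ ⟦ B ⟧
⟦ A ⇒□ B ⟧ = ⟦ A ⟧ ⟶ ⟦ B ⟧
⟦ □ A ⟧    = capped ⟦ A ⟧₀ ⟦ A ⟧

⟦axiom°⟧₀ : ∀ {φ} → AxGLP φ → ⟦ φ ° ⟧₀ ≡ 1ᵍ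
⟦axiom°⟧₀ (A1 φ ψ χ)   = ⟶-A1 ⟦ φ ° ⟧₀ ⟦ ψ ° ⟧₀ ⟦ χ ° ⟧₀
⟦axiom°⟧₀ (A2 φ ψ)     = ⟶-A2 ⟦ φ ° ⟧₀ ⟦ ψ ° ⟧₀
⟦axiom°⟧₀ (A3 φ ψ)     = ⟶-A3 ⟦ φ ° ⟧₀ ⟦ ψ ° ⟧₀
⟦axiom°⟧₀ (A5a φ ψ χ)  = ⟶-A5a ⟦ φ ° ⟧₀ ⟦ ψ ° ⟧₀ ⟦ χ ° ⟧₀
⟦axiom°⟧₀ (A5b φ ψ χ)  = ⟶-A5b ⟦ φ ° ⟧₀ ⟦ ψ ° ⟧₀ ⟦ χ ° ⟧₀
⟦axiom°⟧₀ (A6 φ ψ χ)   = ⟶-A6 ⟦ φ ° ⟧₀ ⟦ ψ ° ⟧₀ ⟦ χ ° ⟧₀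
⟦axiom°⟧₀ (A7 φ)       = refl
⟦axiom°⟧₀ (G4 φ)       = ⟶-G4 ⟦ φ ° ⟧₀
⟦axiom°⟧₀ (AJ t s φ ψ) = ⟶-refl (⟦ φ ° ⟧₀ ⟶ ⟦ ψ ° ⟧₀)
⟦axiom°⟧₀ (A+l t s φ)  = ⟶-refl ⟦ φ ° ⟧₀
⟦axiom°⟧₀ (A+r t s φ)  = ⟶-refl ⟦ φ ° ⟧₀
⟦axiom°⟧₀ (AF t φ)     = ⟶-refl ⟦ φ ° ⟧₀
⟦axiom°⟧₀ (A! t φ)     = ⟶-refl ⟦ φ ° ⟧₀

⟦axiom°⟧ : ∀ {φ} → AxGLP φ → ⟦ φ ° ⟧ ≡ 1ᵍ
⟦axiom°⟧ (A1 φ ψ χ)   = ⟶-A1 ⟦ φ ° ⟧ ⟦ ψ ° ⟧ ⟦ χ ° ⟧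
⟦axiom°⟧ (A2 φ ψ)     = ⟶-A2 ⟦ φ ° ⟧ ⟦ ψ ° ⟧
⟦axiom°⟧ (A3 φ ψ)     = ⟶-A3 ⟦ φ ° ⟧ ⟦ ψ ° ⟧
⟦axiom°⟧ (A5a φ ψ χ)  = ⟶-A5a ⟦ φ ° ⟧ ⟦ ψ ° ⟧ ⟦ χ ° ⟧
⟦axiom°⟧ (A5b φ ψ χ)  = ⟶-A5b ⟦ φ ° ⟧ ⟦ ψ ° ⟧ ⟦ χ ° ⟧
⟦axiom°⟧ (A6 φ ψ χ)   = ⟶-A6 ⟦ φ ° ⟧ ⟦ ψ ° ⟧ ⟦ χ ° ⟧
⟦axiom°⟧ (A7 φ)       = refl
⟦axiom°⟧ (G4 φ)       = ⟶-G4 ⟦ φ ° ⟧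
⟦axiom°⟧ (AJ t s φ ψ) = capped-K ⟦ φ ° ⟧₀ ⟦ ψ ° ⟧₀ ⟦ φ ° ⟧ ⟦ ψ ° ⟧
⟦axiom°⟧ (A+l t s φ)  = ⟶-refl (capped ⟦ φ ° ⟧₀ ⟦ φ ° ⟧)
⟦axiom°⟧ (A+r t s φ)  = ⟶-refl (capped ⟦ φ ° ⟧₀ ⟦ φ ° ⟧)
⟦axiom°⟧ (AF t φ)     = capped-T ⟦ φ ° ⟧₀ ⟦ φ ° ⟧
⟦axiom°⟧ (A! t φ)     = capped-4 ⟦ φ ° ⟧₀ ⟦ φ ° ⟧

⟦constChain°⟧₀ : ∀ {χ} → ConstChain χ → ⟦ χ ° ⟧₀ ≡ 1ᵍ
⟦constChain°⟧₀ (base _ φ a) = ⟦axiom°⟧₀ a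
⟦constChain°⟧₀ (step _ χ c) = ⟦constChain°⟧₀ c

⟦constChain°⟧ : ∀ {χ} → ConstChain χ → ⟦ χ ° ⟧ ≡ 1ᵍ
⟦constChain°⟧ (base _ φ a) rewrite ⟦axiom°⟧₀ a       = ⟦axiom°⟧ a
⟦constChain°⟧ (step _ χ c) rewrite ⟦constChain°⟧₀ c = ⟦constChain°⟧ c

⟦forget⟧ : ∀ CS φ → GLP⊢ CS φ → ⟦ φ ° ⟧ ≡ 1ᵍ
⟦forget⟧ CS φ (ax a)   = ⟦axiom°⟧ a
⟦forget⟧ CS φ (mp d e) = ⟶-mp (⟦forget⟧ CS _ d) (⟦forget⟧ CS _ e)
⟦forget⟧ CS φ (ans m)  = ⟦constChain°⟧ (ConstSpec.shape CS _ m)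

Z-p₀ : Fm□
Z-p₀ = (¬□ (¬□ (□ (p□ 0)))) ⇒□ (□ (¬□ (¬□ (p□ 0))))

⟦Z-p₀⟧≢1 : ⟦ Z-p₀ ⟧ ≢ 1ᵍ
⟦Z-p₀⟧≢1 ()

mainTheorem12 : (CS : ConstSpec) → ProperSubsetThm CS
mainTheorem12 CS = ⊢□-forget CS , Z-p₀ , Z (p□ 0) , not-projection
  where
  not-projection : ¬ (Σ FmJ λ φ → GLP⊢ CS φ × (φ ° ≡ Z-p₀))
  not-projection (φ , d , φ°≡Z) = ⟦Z-p₀⟧≢1 (subst (λ ψ → ⟦ ψ ⟧ ≡ 1ᵍ) φ°≡Z (⟦forget⟧ CS φ d))
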